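{- Let $i\in I_0$ and let $b\in\mathcal{B}^{\otimes\ell}$ be $\{1,2,\dots,i-1\}$-highest weight (no condition if $i=1$). If the first (leftmost) letter of $b$ that lies in $\{i,i+1\}$ is $i+1$, then $\varepsilon_{ -i}(b)=1$.
   Context: Fix $n\ge1$, $\ell\ge1$, $I_0=\{1,\dots,n\}$. $\mathcal{B}^{\otimes\ell}$ is the set of words $b=b_1\cdots b_\ell$ with letters in $\{1,\dots,n+1\}$. Operators map to $\mathcal{B}^{\otimes\ell}\sqcup\{0\}$ and send $0$ to $0$; products denote composition (rightmost first). For $i\in I_0$: in the subsequence of letters equal to $i$ or $i+1$, repeatedly pair an $i+1$ with an $i$ immediately to its right in the current subsequence and remove the pair; $f_i$ changes the rightmost unpaired $i$ to $i+1$, $e_i$ the leftmost unpaired $i+1$ to $i$ ($0$ if none). $\varphi_i,\varepsilon_i$ are the maximal numbers of applications of $f_i$, $e_i$ giving nonzero results, and $s_i(b)=f_i^m(b)$ if $m=\varphi_i(b)-\varepsilon_i(b)\ge0$, $s_i(b)=e_i^{ -m}(b)$ if $m<0$. $e_{ -1}(b)$ changes the leftmost letter of $b$ lying in $\{1,2\}$ to $1$ if it is $2$ (else $0$). For $1<i\le n$: $e_{ -i}=s_{i-1}\cdots s_1s_i\cdots s_2\,e_{ -1}\,s_2\cdots s_is_1\cdots s_{i-1}$; $\varepsilon_{ -i}(b)=\max\{k:e_{ -i}^kb\ne0\}$. $b$ is $J$-highest weight ($J\subseteq I_0$) if $e_j(b)=0$ for all $j\in J$. -}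

module Defs where

open import Data.Nat using (ℕ; zero; suc; _∸_; _≡ᵇ_; _<_; _≤ᵇ_)
open import Data.Bool using (Bool; true; false; if_then_else_; _∨_)
open import Data.List using (List; []; _∷_; length; map; reverse; _++_)
open import Data.Maybe using (Maybe; just; nothing; _>>=_)
open import Data.Product using (_×_; _,_; proj₁)
open import Relation.Binary.PropositionalEquality using (_≡_; _≢_)

-- Words b = b₁ ⋯ b_ℓ are lists of natural numbers (letters 1 … n+1).
-- Operators return  Maybe Word ; the crystal "0" is  nothing .
Word : Set
Word = List ℕ

Op : Set
Op = Word → Maybe Word

_⊙_ : Op → Op → Op
(g ⊙ h) b = h b >>= g

iterOp : Op → ℕ → Word → Maybe Word
iterOp g zero    b = just b
iterOp g (suc k) b = iterOp g k b >>= g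

-- Bracketing for the letters i , i+1.
-- Left-to-right scan; o = number of currently unmatched (i+1)'s to the left.
-- An i is unpaired iff there is no unmatched i+1 to its left to pair with.
-- Flag true = this position carries an unpaired i.
markI : ℕ → ℕ → Word → List Bool
markI i o [] = []
markI i o (x ∷ xs) =
  if x ≡ᵇ i
  then (if o ≡ᵇ 0 then true ∷ markI i 0 xs else false ∷ markI i (o ∸ 1) xs)
  else (if x ≡ᵇ suc i then false ∷ markI i (suc o) xs else false ∷ markI i o xs)

-- Right-to-left scan; c = number of currently unmatched i's to the right.
-- Flag true = this position carries an unpaired i+1.
markJrev : ℕ → ℕ → Word → List Bool
markJrev i c [] = []
markJrev i c (x ∷ xs) =
  if x ≡ᵇ i
  then false ∷ markJrev i (suc c) xs
  else (if x ≡ᵇ suc i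
        then (if c ≡ᵇ 0 then true ∷ markJrev i 0 xs else false ∷ markJrev i (c ∸ 1) xs)
        else false ∷ markJrev i c xs)

markJ : ℕ → Word → List Bool
markJ i b = reverse (markJrev i 0 (reverse b))

zipB : Word → List Bool → List (ℕ × Bool)
zipB [] _ = []
zipB (x ∷ xs) [] = (x , false) ∷ zipB xs []
zipB (x ∷ xs) (f ∷ fs) = (x , f) ∷ zipB xs fs

changeLast : ℕ → List (ℕ × Bool) → Maybe Word
changeLast y [] = nothing
changeLast y ((x , fl) ∷ rest) with changeLast y rest
... | just r  = just (x ∷ r)
... | nothing = if fl then just (y ∷ map proj₁ rest) else nothing

changeFirst : ℕ → List (ℕ × Bool) → Maybe Word
changeFirst y [] = nothing
changeFirst y ((x , fl) ∷ rest) =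
  if fl then just (y ∷ map proj₁ rest)
  else (changeFirst y rest >>= λ r → just (x ∷ r))

f : ℕ → Op
f i b = changeLast (suc i) (zipB b (markI i 0 b))

e : ℕ → Op
e i b = changeFirst i (zipB b (markJ i b))

-- maximal number of successive applications of g giving a nonzero result,
-- searched up to the bound  fuel  (each f_i / e_i application lowers the
-- number of letters i resp. i+1, so fuel = length b suffices)
maxApps : Op → ℕ → Word → ℕ
maxApps g zero    b = 0
maxApps g (suc k) b with g b
... | nothing = 0
... | just b' = suc (maxApps g k b')

φ : ℕ → Word → ℕ
φ i b = maxApps (f i) (length b) b

ε : ℕ → Word → ℕ
ε i b = maxApps (e i) (length b) b

s : ℕ → Op
s i b = if ε i b ≤ᵇ φ i b
        then iterOp (f i) (φ i b ∸ ε i b) b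
        else iterOp (e i) (ε i b ∸ φ i b) b

eNeg1 : Op
eNeg1 [] = nothing
eNeg1 (x ∷ xs) =
  if x ≡ᵇ 1 then nothing
  else (if x ≡ᵇ 2 then just (1 ∷ xs) else (eNeg1 xs >>= λ r → just (x ∷ r)))

down : ℕ → ℕ → List ℕ
down zero    c = if c ≡ᵇ 0 then 0 ∷ [] else []
down (suc a) c = if c ≤ᵇ suc a then suc a ∷ down a c else []

applySeq : List ℕ → Op
applySeq [] b = just b
applySeq (j ∷ js) b = s j b >>= applySeq js

-- e_{-i} = s_{i-1}⋯s_1 s_i⋯s_2 e_{-1} s_2⋯s_i s_1⋯s_{i-1}  (rightmost first).
-- Acting on b, first s_{i-1}, …, s_1, then s_i, …, s_2, then e_{-1},
-- then s_2, …, s_i, then s_1, …, s_{i-1}.  For i = 1 this is e_{-1}.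
preSeq : ℕ → List ℕ
preSeq i = down (i ∸ 1) 1 ++ down i 2

eNeg : ℕ → Op
eNeg i b = applySeq (preSeq i) b >>= λ b₁ → eNeg1 b₁ >>= applySeq (reverse (preSeq i))

EpsNegIs : ℕ → Word → ℕ → Set
EpsNegIs i b k = (iterOp (eNeg i) k b ≢ nothing) × (∀ m → k < m → iterOp (eNeg i) m b ≡ nothing)

firstIn : ℕ → Word → Maybe ℕ
firstIn i [] = nothing
firstIn i (x ∷ xs) = if (x ≡ᵇ i) ∨ (x ≡ᵇ suc i) then just x else firstIn i xs

-- Write γ = s_2 ⋯ s_i s_1 ⋯ s_{i-1}, so that e_{-i} = γ⁻¹ e_{-1} γ, every s_j being an involution.
-- It suffices that the first letter of γ b in {1,2} is a 2: then e_{-1} turns it into a 1, after which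
-- e_{-1} vanishes, so e_{-i} b ≠ 0 = e_{-i}² b.
--
-- First apply s_{i-1}, …, s_1. Before s_a is applied the word is {1,…,a}-highest weight, so s_a raises
-- exactly its unpaired a's (and keeps it {1,…,a-1}-highest weight); every remaining a is paired, hence
-- preceded by an a+1. By induction every letter a is then preceded by the subsequence i+1, i, …, a+1,
-- the case a = i being the hypothesis on the first letter of b in {i,i+1}. Now apply s_i, …, s_2. If the
-- first 1 is preceded by K+1, K, …, 2, the K after the K+1 is paired, so s_K keeps it, and s_K does not
-- touch smaller letters: the first 1 is now preceded by K, …, 2. If there is no 1, a letter K+1 leaves a
-- letter K behind. In the end the first 1 is preceded by a 2, or there is a 2 and no 1.

module Submission where

open import Defs
open import Data.Nat using (ℕ; zero; suc; pred; _≤_; _<_; _+_; _∸_; _≡ᵇ_; _≤ᵇ_; z≤n; s≤s; _≟_)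
open import Data.Nat.Properties
  using ( ≡ᵇ⇒≡; 1+n≢n; 1+n≰n; >⇒≢; <⇒≢; <⇒≱; ≤-refl; ≤-trans; ≤-reflexive; <⇒≤; ≤-pred; ≤∧≢⇒<; n≤1+n
        ; m≤n⇒m≤1+n; m<n⇒m<1+n; m<n⇒0<n∸m; m≤m+n; m≤n+m; +-suc; +-identityʳ; m∸n≤m; m∸n+n≡m; m+[n∸m]≡n
        ; m∸[m∸n]≡n; n∸n≡0; ∸-monoˡ-≤; ≰⇒>; ≤ᵇ-reflects-≤ )
open import Data.Bool using (Bool; true; false; if_then_else_; _∨_; T)
open import Data.List using (List; []; _∷_; length; map; reverse; _++_; [_])
open import Data.List.Properties
  using (++-assoc; map-++; ∷-injective; unfold-reverse; reverse-involutive; ++-identityʳ; length-++-≤ʳ)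
open import Data.List.Relation.Unary.All as All using (All; []; _∷_)
open import Data.List.Relation.Unary.Any using (here; there)
open import Data.List.Relation.Binary.Pointwise using (Pointwise; []; _∷_; ++⁺)
open import Data.List.Relation.Binary.Sublist.Propositional using (_⊆_; []; _∷_; _∷ʳ_; minimum; to∈; from∈)
open import Data.List.Relation.Binary.Sublist.Propositional.Properties using (∷ˡ⁻) renaming (++⁺ to ⊆-++⁺)
open import Data.List.Membership.Propositional using (_∈_; _∉_)
open import Data.List.Membership.Propositional.Properties using (∈-++⁻; ∈-++⁺ˡ; ∈-++⁺ʳ; ∈-∃++)
open import Data.List.Membership.DecPropositional _≟_ using (_∈?_)
open import Data.Maybe using (Maybe; just; nothing; _>>=_; maybe′)
import Data.Maybe as Maybe
open import Data.Maybe.Properties using (just-injective; map-id; map-∘)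
open import Data.Product using (∃; ∃₂; _×_; _,_; proj₁; proj₂)
open import Data.Sum using (_⊎_; inj₁; inj₂)
open import Data.Empty using (⊥-elim)
open import Data.Unit using (tt)
open import Relation.Nullary using (yes; no)
open import Relation.Nullary.Reflects using (Reflects; ofʸ; ofⁿ)
open import Relation.Binary.PropositionalEquality
  using (_≡_; _≢_; refl; sym; trans; cong; cong₂; subst; module ≡-Reasoning)

≡ᵇ-refl : ∀ k → (k ≡ᵇ k) ≡ true
≡ᵇ-refl zero    = refl
≡ᵇ-refl (suc k) = ≡ᵇ-refl k

≢⇒≡ᵇ-false : ∀ {x k} → x ≢ k → (x ≡ᵇ k) ≡ false
≢⇒≡ᵇ-false {x} {k} x≢k with x ≡ᵇ k in eq
... | true  = ⊥-elim (x≢k (≡ᵇ⇒≡ x k (subst T (sym eq) tt)))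
... | false = refl

maxApps-just : ∀ (g : Op) fuel b {b′} → g b ≡ just b′ → maxApps g (suc fuel) b ≡ suc (maxApps g fuel b′)
maxApps-just g fuel b eq with g b | eq
... | just _ | refl = refl

maxApps-nothing : ∀ (g : Op) fuel b → g b ≡ nothing → maxApps g (suc fuel) b ≡ 0
maxApps-nothing g fuel b eq with g b | eq
... | nothing | refl = refl

iterOp-+-nothing : ∀ (g : Op) b k d → iterOp g k b ≡ nothing → iterOp g (d + k) b ≡ nothing
iterOp-+-nothing g b k zero    h = h
iterOp-+-nothing g b k (suc d) h rewrite iterOp-+-nothing g b k d h = refl

iterOp-≤-nothing : ∀ (g : Op) b {k m} → k ≤ m → iterOp g k b ≡ nothing → iterOp g m b ≡ nothing
iterOp-≤-nothing g b {k} {m} k≤m h =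
  subst (λ j → iterOp g j b ≡ nothing) (m∸n+n≡m k≤m) (iterOp-+-nothing g b k (m ∸ k) h)

applySeq-++ : ∀ xs ys b → applySeq (xs ++ ys) b ≡ (applySeq xs b >>= applySeq ys)
applySeq-++ []       ys b = refl
applySeq-++ (j ∷ xs) ys b with s j b
... | nothing = refl
... | just b′ = applySeq-++ xs ys b′

unflagged : Word → List (ℕ × Bool)
unflagged = map (_, false)

unflags : Word → List Bool
unflags = map (λ _ → false)

map-proj₁-zipB : ∀ w fs → map proj₁ (zipB w fs) ≡ w
map-proj₁-zipB []      fs       = refl
map-proj₁-zipB (x ∷ w) []       = cong (x ∷_) (map-proj₁-zipB w [])
map-proj₁-zipB (x ∷ w) (_ ∷ fs) = cong (x ∷_) (map-proj₁-zipB w fs)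

map-proj₁-unflagged-++ : ∀ B {r w} → map proj₁ r ≡ w → map proj₁ (unflagged B ++ r) ≡ B ++ w
map-proj₁-unflagged-++ []      eq = eq
map-proj₁-unflagged-++ (x ∷ B) eq = cong (x ∷_) (map-proj₁-unflagged-++ B eq)

zipB-unflags-++ : ∀ B t gs → zipB (B ++ t) (unflags B ++ gs) ≡ unflagged B ++ zipB t gs
zipB-unflags-++ []      t gs = refl
zipB-unflags-++ (x ∷ B) t gs = cong ((x , false) ∷_) (zipB-unflags-++ B t gs)

unflagged-++-∷ : ∀ B {x} C t → unflagged B ++ (x , false) ∷ unflagged C ++ t ≡ unflagged (B ++ x ∷ C) ++ t
unflagged-++-∷ []      C t = refl
unflagged-++-∷ (y ∷ B) C t = cong ((y , false) ∷_) (unflagged-++-∷ B C t)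

unflags-++-∷ : ∀ B {x} C t → unflags B ++ false ∷ unflags C ++ t ≡ unflags (B ++ x ∷ C) ++ t
unflags-++-∷ []      C t = refl
unflags-++-∷ (y ∷ B) C t = cong (false ∷_) (unflags-++-∷ B C t)

changeLast-unflagged-∷ : ∀ y x r → changeLast y ((x , false) ∷ r) ≡ Maybe.map (x ∷_) (changeLast y r)
changeLast-unflagged-∷ y x r with changeLast y r
... | just _  = refl
... | nothing = refl

changeLast-flagged-∷ : ∀ y x r →
  changeLast y ((x , true) ∷ r) ≡ just (maybe′ (x ∷_) (y ∷ map proj₁ r) (changeLast y r))
changeLast-flagged-∷ y x r with changeLast y r
... | just _  = refl
... | nothing = refl

changeLast-unflagged-++ : ∀ y B t → changeLast y (unflagged B ++ t) ≡ Maybe.map (B ++_) (changeLast y t)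
changeLast-unflagged-++ y []      t = sym (map-id (changeLast y t))
changeLast-unflagged-++ y (x ∷ B) t
  rewrite changeLast-unflagged-∷ y x (unflagged B ++ t) | changeLast-unflagged-++ y B t =
  sym (map-∘ (changeLast y t))

changeFirst-unflagged-++ : ∀ y B t → changeFirst y (unflagged B ++ t) ≡ Maybe.map (B ++_) (changeFirst y t)
changeFirst-unflagged-++ y []      t = sym (map-id (changeFirst y t))
changeFirst-unflagged-++ y (x ∷ B) t rewrite changeFirst-unflagged-++ y B t with changeFirst y t
... | just _  = refl
... | nothing = refl

changeFirst-all-false : ∀ y w {fs} → All (_≡ false) fs → changeFirst y (zipB w fs) ≡ nothing
changeFirst-all-false y []      _          = refl
changeFirst-all-false y (x ∷ w) []         rewrite changeFirst-all-false y w [] = refl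
changeFirst-all-false y (x ∷ w) (refl ∷ a) rewrite changeFirst-all-false y w a  = refl

changeFirst-nothing⇒all-false : ∀ y w fs → length fs ≡ length w →
                                changeFirst y (zipB w fs) ≡ nothing → All (_≡ false) fs
changeFirst-nothing⇒all-false y []      []           _   _ = []
changeFirst-nothing⇒all-false y (x ∷ w) (true ∷ fs)  _   ()
changeFirst-nothing⇒all-false y (x ∷ w) (false ∷ fs) len h with changeFirst y (zipB w fs) in eq
... | nothing = refl ∷ changeFirst-nothing⇒all-false y w fs (cong pred len) eq

⊆-transfer : ∀ {R : ℕ × Bool → ℕ → Set} {P : ℕ → Set} → (∀ {x b y} → R (x , b) y → P x → y ≡ x) →
             ∀ {zs ys ρ} → Pointwise R zs ys → ρ ⊆ map proj₁ zs → All P ρ → ρ ⊆ ys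
⊆-transfer keeps []       []         _          = []
⊆-transfer keeps (r ∷ pw) (_ ∷ʳ p)   aP         = _ ∷ʳ ⊆-transfer keeps pw p aP
⊆-transfer keeps (r ∷ pw) (refl ∷ p) (px ∷ aP) rewrite keeps r px = refl ∷ ⊆-transfer keeps pw p aP

∈-transfer⁻ : ∀ {R : ℕ × Bool → ℕ → Set} {x} → (∀ {z} → R z x → proj₁ z ≡ x) →
              ∀ {zs ys} → Pointwise R zs ys → x ∈ ys → x ∈ map proj₁ zs
∈-transfer⁻ h (r ∷ pw) (here refl) = here (sym (h r))
∈-transfer⁻ h (r ∷ pw) (there p) = there (∈-transfer⁻ h pw p)

Pointwise-++ʳ⁻ : ∀ {A B : Set} {R : A → B → Set} {zs} ys₁ ys₂ → Pointwise R zs (ys₁ ++ ys₂) →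
                 ∃₂ λ zs₁ zs₂ → zs ≡ zs₁ ++ zs₂ × Pointwise R zs₁ ys₁ × Pointwise R zs₂ ys₂
Pointwise-++ʳ⁻ []        ys₂ pw       = [] , _ , refl , [] , pw
Pointwise-++ʳ⁻ (y ∷ ys₁) ys₂ (r ∷ pw) with Pointwise-++ʳ⁻ ys₁ ys₂ pw
... | zs₁ , zs₂ , refl , p₁ , p₂ = _ ∷ zs₁ , zs₂ , refl , r ∷ p₁ , p₂

Pointwise-++ˡ⁻ : ∀ {A B : Set} {R : A → B → Set} zs₁ zs₂ {ys} → Pointwise R (zs₁ ++ zs₂) ys →
                 ∃₂ λ ys₁ ys₂ → ys ≡ ys₁ ++ ys₂ × Pointwise R zs₁ ys₁ × Pointwise R zs₂ ys₂
Pointwise-++ˡ⁻ []        zs₂ pw       = [] , _ , refl , [] , pw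
Pointwise-++ˡ⁻ (z ∷ zs₁) zs₂ (r ∷ pw) with Pointwise-++ˡ⁻ zs₁ zs₂ pw
... | ys₁ , ys₂ , refl , p₁ , p₂ = _ ∷ ys₁ , ys₂ , refl , r ∷ p₁ , p₂

module String (k L : ℕ) (x : ℕ → Word)
  (f-bottom : f k (x 0) ≡ nothing)
  (f-down   : ∀ m → m < L → f k (x (suc m)) ≡ just (x m))
  (e-up     : ∀ m → m < L → e k (x m) ≡ just (x (suc m)))
  (e-top    : e k (x L) ≡ nothing)
  (L≤length : ∀ m → L ≤ length (x m)) where

  maxApps-f : ∀ m fuel → m ≤ fuel → m ≤ L → maxApps (f k) fuel (x m) ≡ m
  maxApps-f zero    zero       _         _   = refl
  maxApps-f zero    (suc fuel) _         _   = maxApps-nothing (f k) fuel (x 0) f-bottom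
  maxApps-f (suc m) (suc fuel) (s≤s m≤) m<L =
    trans (maxApps-just (f k) fuel (x (suc m)) (f-down m m<L)) (cong suc (maxApps-f m fuel m≤ (<⇒≤ m<L)))

  maxApps-e : ∀ m d fuel → m + d ≡ L → d ≤ fuel → maxApps (e k) fuel (x m) ≡ d
  maxApps-e m zero    zero       _  _ = refl
  maxApps-e m zero    (suc fuel) eq _ rewrite +-identityʳ m | eq = maxApps-nothing (e k) fuel (x L) e-top
  maxApps-e m (suc d) (suc fuel) eq (s≤s d≤) =
    trans (maxApps-just (e k) fuel (x m) (e-up m m<L))
          (cong suc (maxApps-e (suc m) d fuel (trans (sym (+-suc m d)) eq) d≤))
    where
    m<L : m < L
    m<L = ≤-trans (s≤s (m≤m+n m d)) (≤-reflexive (trans (sym (+-suc m d)) eq))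

  φ-string : ∀ m → m ≤ L → φ k (x m) ≡ m
  φ-string m m≤L = maxApps-f m _ (≤-trans m≤L (L≤length m)) m≤L

  ε-string : ∀ m → m ≤ L → ε k (x m) ≡ L ∸ m
  ε-string m m≤L = maxApps-e m (L ∸ m) _ (m+[n∸m]≡n m≤L) (≤-trans (m∸n≤m L m) (L≤length m))

  iterate-f : ∀ j r → j + r ≤ L → iterOp (f k) j (x (j + r)) ≡ just (x r)
  iterate-f zero    r _ = refl
  iterate-f (suc j) r le rewrite sym (+-suc j r) | iterate-f j (suc r) le = f-down r (≤-trans (m≤n+m (suc r) j) le)

  iterate-e : ∀ j m → m + j ≤ L → iterOp (e k) j (x m) ≡ just (x (m + j))
  iterate-e zero    m _  rewrite +-identityʳ m = refl
  iterate-e (suc j) m le rewrite +-suc m j | iterate-e j m (≤-trans (n≤1+n (m + j)) le) = e-up (m + j) le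

  s-string : ∀ m → m ≤ L → s k (x m) ≡ just (x (L ∸ m))
  s-string m m≤L =
    trans (cong₂ reflect (ε-string m m≤L) (φ-string m m≤L)) (by-direction (≤ᵇ-reflects-≤ (L ∸ m) m))
    where
    reflect : ℕ → ℕ → Maybe Word
    reflect εm φm = if εm ≤ᵇ φm then iterOp (f k) (φm ∸ εm) (x m) else iterOp (e k) (εm ∸ φm) (x m)
    by-direction : ∀ {b} → Reflects ((L ∸ m) ≤ m) b →
                   (if b then iterOp (f k) (m ∸ (L ∸ m)) (x m) else iterOp (e k) ((L ∸ m) ∸ m) (x m)) ≡ just (x (L ∸ m))
    by-direction (ofʸ le) =
      subst (λ y → iterOp (f k) (m ∸ (L ∸ m)) (x y) ≡ just (x (L ∸ m))) (m∸n+n≡m le)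
            (iterate-f (m ∸ (L ∸ m)) (L ∸ m) (≤-trans (≤-reflexive (m∸n+n≡m le)) m≤L))
    by-direction (ofⁿ nle) =
      trans (iterate-e ((L ∸ m) ∸ m) m (≤-trans (≤-reflexive (m+[n∸m]≡n m≤L∸m)) (m∸n≤m L m)))
            (cong (λ y → just (x y)) (m+[n∸m]≡n m≤L∸m))
      where
      m≤L∸m : m ≤ L ∸ m
      m≤L∸m = <⇒≤ (≰⇒> nle)

module Signature (k : ℕ) where

  open ≡-Reasoning

  unpairedFlag : ℕ → ℕ → Bool
  unpairedFlag x o = if x ≡ᵇ k then (o ≡ᵇ 0) else false

  openAfter : ℕ → ℕ → ℕ
  openAfter x o = if x ≡ᵇ k then o ∸ 1 else (if x ≡ᵇ suc k then suc o else o)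

  markI-∷ : ∀ o x w → markI k o (x ∷ w) ≡ unpairedFlag x o ∷ markI k (openAfter x o) w
  markI-∷ o x w with x ≡ᵇ k
  markI-∷ zero    x w | true = refl
  markI-∷ (suc o) x w | true = refl
  ... | false with x ≡ᵇ suc k
  ... | true  = refl
  ... | false = refl

  annotate : ℕ → Word → List (ℕ × Bool)
  annotate o w = zipB w (markI k o w)

  annotate-∷ : ∀ o x w → annotate o (x ∷ w) ≡ (x , unpairedFlag x o) ∷ annotate (openAfter x o) w
  annotate-∷ o x w rewrite markI-∷ o x w = refl

  annotate-suc-k : ∀ o w → annotate o (suc k ∷ w) ≡ (suc k , false) ∷ annotate (suc o) w
  annotate-suc-k o w rewrite ≢⇒≡ᵇ-false (1+n≢n {k}) | ≡ᵇ-refl k = refl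

  annotate-k-paired : ∀ o w → annotate (suc o) (k ∷ w) ≡ (k , false) ∷ annotate o w
  annotate-k-paired o w rewrite ≡ᵇ-refl k = refl

  annotate-k-unpaired : ∀ w → annotate 0 (k ∷ w) ≡ (k , true) ∷ annotate 0 w
  annotate-k-unpaired w rewrite ≡ᵇ-refl k = refl

  annotate-other : ∀ {x} o w → x ≢ k → x ≢ suc k → annotate o (x ∷ w) ≡ (x , false) ∷ annotate o w
  annotate-other o w x≢k x≢k+1 rewrite ≢⇒≡ᵇ-false x≢k | ≢⇒≡ᵇ-false x≢k+1 = refl

  map-proj₁-annotate : ∀ o w → map proj₁ (annotate o w) ≡ w
  map-proj₁-annotate o w = map-proj₁-zipB w (markI k o w)

  annotate-++ : ∀ o P t → ∃ λ o′ → annotate o (P ++ t) ≡ annotate o P ++ annotate o′ t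
  annotate-++ o []      t = o , refl
  annotate-++ o (x ∷ P) t with annotate-++ (openAfter x o) P t
  ... | o′ , eq = o′ , trans (annotate-∷ o x (P ++ t))
                             (trans (cong ((x , unpairedFlag x o) ∷_) eq)
                                    (cong (_++ annotate o′ t) (sym (annotate-∷ o x P))))

  unpairedFlag-false⇒open : ∀ o → unpairedFlag k o ≡ false → 0 < o
  unpairedFlag-false⇒open zero h rewrite ≡ᵇ-refl k with () ← h
  unpairedFlag-false⇒open (suc o) _ = s≤s z≤n

  openAfter-≤ : ∀ {x} o → x ≢ suc k → openAfter x o ≤ o
  openAfter-≤ {x} o x≢k+1 with x ≟ k
  ... | yes refl rewrite ≡ᵇ-refl k = m∸n≤m o 1
  ... | no x≢k rewrite ≢⇒≡ᵇ-false x≢k | ≢⇒≡ᵇ-false x≢k+1 = ≤-refl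

  paired-k⇒opener : ∀ o w ZX ZY → annotate o w ≡ ZX ++ (k , false) ∷ ZY → 0 < o ⊎ suc k ∈ map proj₁ ZX
  paired-k⇒opener o (x ∷ w) [] ZY eq with ∷-injective (trans (sym (annotate-∷ o x w)) eq)
  ... | head≡ , _ with cong proj₁ head≡
  ... | refl = inj₁ (unpairedFlag-false⇒open o (cong proj₂ head≡))
  paired-k⇒opener o (x ∷ w) (z ∷ ZX) ZY eq with ∷-injective (trans (sym (annotate-∷ o x w)) eq)
  ... | refl , eq′ with paired-k⇒opener (openAfter x o) w ZX ZY eq′ | x ≟ suc k
  ... | inj₂ p    | _        = inj₂ (there p)
  ... | inj₁ _    | yes refl = inj₂ (here refl)
  ... | inj₁ 0<o′ | no x≢k+1 = inj₁ (≤-trans 0<o′ (openAfter-≤ o x≢k+1))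

  data PairedKThen (ρ : Word) : List (ℕ × Bool) → Set where
    here  : ∀ {zs} → ρ ⊆ map proj₁ zs → PairedKThen ρ ((k , false) ∷ zs)
    there : ∀ {z zs} → PairedKThen ρ zs → PairedKThen ρ (z ∷ zs)

  first-k-paired : ∀ o ys {ρ} → k ∷ ρ ⊆ ys → PairedKThen ρ (annotate (suc o) ys)
  first-k-paired o (y ∷ ys) {ρ} (refl ∷ p) rewrite annotate-k-paired o ys =
    here (subst (ρ ⊆_) (sym (map-proj₁-annotate o ys)) p)
  first-k-paired o (y ∷ ys) {ρ} (.y ∷ʳ p) with y ≟ k | y ≟ suc k
  ... | yes refl | _        rewrite annotate-k-paired o ys =
    here (subst (ρ ⊆_) (sym (map-proj₁-annotate o ys)) (∷ˡ⁻ p))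
  ... | no _     | yes refl rewrite annotate-suc-k (suc o) ys = there (first-k-paired (suc o) ys p)
  ... | no y≢k   | no y≢k+1 rewrite annotate-other (suc o) ys y≢k y≢k+1 = there (first-k-paired o ys p)

  opener-then-paired-k : ∀ o P {ρ} → suc k ∷ k ∷ ρ ⊆ P → PairedKThen ρ (annotate o P)
  opener-then-paired-k o (y ∷ P) (refl ∷ p) rewrite annotate-suc-k o P = there (first-k-paired o P p)
  opener-then-paired-k o (y ∷ P) (.y ∷ʳ p) rewrite annotate-∷ o y P = there (opener-then-paired-k (openAfter y o) P p)

  data Balanced : Word → Set where
    []    : Balanced []
    other : ∀ {x B} → x ≢ k → x ≢ suc k → Balanced B → Balanced (x ∷ B)
    pair  : ∀ {B₁ B₂} → Balanced B₁ → Balanced B₂ → Balanced (suc k ∷ B₁ ++ k ∷ B₂)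

  annotate-balanced-++ : ∀ {B} → Balanced B → ∀ o t → annotate o (B ++ t) ≡ unflagged B ++ annotate o t
  annotate-balanced-++ [] o t = refl
  annotate-balanced-++ (other {x} {B} x≢k x≢k+1 b) o t =
    trans (annotate-other o (B ++ t) x≢k x≢k+1) (cong ((x , false) ∷_) (annotate-balanced-++ b o t))
  annotate-balanced-++ (pair {B₁} {B₂} b₁ b₂) o t = begin
    annotate o (suc k ∷ (B₁ ++ k ∷ B₂) ++ t)
      ≡⟨ cong (λ u → annotate o (suc k ∷ u)) (++-assoc B₁ (k ∷ B₂) t) ⟩
    annotate o (suc k ∷ B₁ ++ k ∷ B₂ ++ t)
      ≡⟨ annotate-suc-k o _ ⟩
    (suc k , false) ∷ annotate (suc o) (B₁ ++ k ∷ B₂ ++ t)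
      ≡⟨ cong ((suc k , false) ∷_) (annotate-balanced-++ b₁ (suc o) _) ⟩
    (suc k , false) ∷ unflagged B₁ ++ annotate (suc o) (k ∷ B₂ ++ t)
      ≡⟨ cong (λ u → (suc k , false) ∷ unflagged B₁ ++ u) (annotate-k-paired o _) ⟩
    (suc k , false) ∷ unflagged B₁ ++ (k , false) ∷ annotate o (B₂ ++ t)
      ≡⟨ cong (λ u → (suc k , false) ∷ unflagged B₁ ++ (k , false) ∷ u) (annotate-balanced-++ b₂ o t) ⟩
    (suc k , false) ∷ unflagged B₁ ++ (k , false) ∷ unflagged B₂ ++ annotate o t
      ≡⟨ cong ((suc k , false) ∷_) (unflagged-++-∷ B₁ B₂ (annotate o t)) ⟩
    unflagged (suc k ∷ B₁ ++ k ∷ B₂) ++ annotate o t ∎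

  -- blocks m [B₁, …, B_L] is k B₁ ⋯ k B_m (k+1) B_{m+1} ⋯ (k+1) B_L: with balanced Bᵢ its
  -- k-signature reduces to kᵐ (k+1)^(L−m), and every word has this shape after a balanced prefix.
  blocks : ℕ → List Word → Word
  blocks m       []       = []
  blocks zero    (B ∷ Bs) = suc k ∷ B ++ blocks zero Bs
  blocks (suc m) (B ∷ Bs) = k ∷ B ++ blocks m Bs

  length-blocks : ∀ m Bs → length Bs ≤ length (blocks m Bs)
  length-blocks m       []       = z≤n
  length-blocks zero    (B ∷ Bs) = s≤s (≤-trans (length-blocks zero Bs) (length-++-≤ʳ (blocks zero Bs) {B}))
  length-blocks (suc m) (B ∷ Bs) = s≤s (≤-trans (length-blocks m Bs) (length-++-≤ʳ (blocks m Bs) {B}))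

  changeLast-blocks-zero : ∀ o {Bs} → All Balanced Bs → changeLast (suc k) (annotate o (blocks 0 Bs)) ≡ nothing
  changeLast-blocks-zero o []                = refl
  changeLast-blocks-zero o {B ∷ Bs} (b ∷ bs)
    rewrite annotate-suc-k o (B ++ blocks 0 Bs) | annotate-balanced-++ b (suc o) (blocks 0 Bs)
          | changeLast-unflagged-++ (suc k) (suc k ∷ B) (annotate (suc o) (blocks 0 Bs))
          | changeLast-blocks-zero (suc o) bs = refl

  changeLast-blocks-suc : ∀ m {Bs} → All Balanced Bs → m < length Bs →
                          changeLast (suc k) (annotate 0 (blocks (suc m) Bs)) ≡ just (blocks m Bs)
  changeLast-blocks-suc m {B ∷ Bs} (b ∷ bs) (s≤s m≤L)
    rewrite annotate-k-unpaired (B ++ blocks m Bs) | annotate-balanced-++ b 0 (blocks m Bs)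
          | changeLast-flagged-∷ (suc k) k (unflagged B ++ annotate 0 (blocks m Bs))
          | changeLast-unflagged-++ (suc k) B (annotate 0 (blocks m Bs)) with m
  ... | zero   rewrite changeLast-blocks-zero 0 bs =
    cong (λ u → just (suc k ∷ u)) (map-proj₁-unflagged-++ B (map-proj₁-annotate 0 (blocks 0 Bs)))
  ... | suc m′ rewrite changeLast-blocks-suc m′ bs m≤L = refl

  -- markJ scans right to left; eCount c w is the number of k's of w left unpaired when c unpaired
  -- k's lie to the right of w, and eFlags marks the unpaired (k+1)'s, recomputed left to right.
  eStep : ℕ → ℕ → ℕ
  eStep x d = if x ≡ᵇ k then suc d else (if x ≡ᵇ suc k then d ∸ 1 else d)

  eFlag : ℕ → ℕ → Bool
  eFlag x d = if x ≡ᵇ k then false else (if x ≡ᵇ suc k then (d ≡ᵇ 0) else false)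

  eCount : ℕ → Word → ℕ
  eCount c []       = c
  eCount c (x ∷ xs) = eStep x (eCount c xs)

  eFlags : ℕ → Word → List Bool
  eFlags c []       = []
  eFlags c (x ∷ xs) = eFlag x (eCount c xs) ∷ eFlags c xs

  markJrev-∷ : ∀ c x xs → markJrev k c (x ∷ xs) ≡ eFlag x c ∷ markJrev k (eStep x c) xs
  markJrev-∷ c x xs with x ≡ᵇ k
  ... | true = refl
  ... | false with x ≡ᵇ suc k
  markJrev-∷ zero    x xs | false | true = refl
  markJrev-∷ (suc c) x xs | false | true = refl
  ... | false = refl

  markJrev-reverse-++ : ∀ w c t → markJrev k c (reverse w ++ t) ≡ reverse (eFlags c w) ++ markJrev k (eCount c w) t
  markJrev-reverse-++ []      c t = refl
  markJrev-reverse-++ (x ∷ w) c t = begin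
    markJrev k c (reverse (x ∷ w) ++ t)       ≡⟨ cong (λ u → markJrev k c (u ++ t)) (unfold-reverse x w) ⟩
    markJrev k c ((reverse w ++ [ x ]) ++ t)  ≡⟨ cong (markJrev k c) (++-assoc (reverse w) [ x ] t) ⟩
    markJrev k c (reverse w ++ x ∷ t)         ≡⟨ markJrev-reverse-++ w c (x ∷ t) ⟩
    reverse (eFlags c w) ++ markJrev k (eCount c w) (x ∷ t)
      ≡⟨ cong (reverse (eFlags c w) ++_) (markJrev-∷ (eCount c w) x t) ⟩
    reverse (eFlags c w) ++ eFlag x (eCount c w) ∷ markJrev k (eCount c (x ∷ w)) t
      ≡⟨ sym (++-assoc (reverse (eFlags c w)) [ eFlag x (eCount c w) ] _) ⟩
    (reverse (eFlags c w) ++ [ eFlag x (eCount c w) ]) ++ markJrev k (eCount c (x ∷ w)) t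
      ≡⟨ cong (_++ markJrev k (eCount c (x ∷ w)) t) (sym (unfold-reverse (eFlag x (eCount c w)) (eFlags c w))) ⟩
    reverse (eFlags c (x ∷ w)) ++ markJrev k (eCount c (x ∷ w)) t ∎

  markJ≡eFlags : ∀ w → markJ k w ≡ eFlags 0 w
  markJ≡eFlags w = begin
    reverse (markJrev k 0 (reverse w))        ≡⟨ cong (λ u → reverse (markJrev k 0 u)) (sym (++-identityʳ (reverse w))) ⟩
    reverse (markJrev k 0 (reverse w ++ []))  ≡⟨ cong reverse (markJrev-reverse-++ w 0 []) ⟩
    reverse (reverse (eFlags 0 w) ++ [])      ≡⟨ cong reverse (++-identityʳ (reverse (eFlags 0 w))) ⟩
    reverse (reverse (eFlags 0 w))            ≡⟨ reverse-involutive (eFlags 0 w) ⟩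
    eFlags 0 w                                ∎

  e-via-eFlags : ∀ w → e k w ≡ changeFirst k (zipB w (eFlags 0 w))
  e-via-eFlags w = cong (λ u → changeFirst k (zipB w u)) (markJ≡eFlags w)

  eStep-k : ∀ d → eStep k d ≡ suc d
  eStep-k d rewrite ≡ᵇ-refl k = refl

  eStep-suc-k : ∀ d → eStep (suc k) d ≡ d ∸ 1
  eStep-suc-k d rewrite ≢⇒≡ᵇ-false (1+n≢n {k}) | ≡ᵇ-refl k = refl

  eStep-other : ∀ {x} d → x ≢ k → x ≢ suc k → eStep x d ≡ d
  eStep-other d x≢k x≢k+1 rewrite ≢⇒≡ᵇ-false x≢k | ≢⇒≡ᵇ-false x≢k+1 = refl

  eFlag-k : ∀ d → eFlag k d ≡ false
  eFlag-k d rewrite ≡ᵇ-refl k = refl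

  eFlag-suc-k : ∀ d → eFlag (suc k) d ≡ (d ≡ᵇ 0)
  eFlag-suc-k d rewrite ≢⇒≡ᵇ-false (1+n≢n {k}) | ≡ᵇ-refl k = refl

  eFlag-other : ∀ {x} d → x ≢ k → x ≢ suc k → eFlag x d ≡ false
  eFlag-other d x≢k x≢k+1 rewrite ≢⇒≡ᵇ-false x≢k | ≢⇒≡ᵇ-false x≢k+1 = refl

  eCount-balanced-++ : ∀ {B} → Balanced B → ∀ c t → eCount c (B ++ t) ≡ eCount c t
  eCount-balanced-++ [] c t = refl
  eCount-balanced-++ (other {x} {B} x≢k x≢k+1 b) c t =
    trans (eStep-other (eCount c (B ++ t)) x≢k x≢k+1) (eCount-balanced-++ b c t)
  eCount-balanced-++ (pair {B₁} {B₂} b₁ b₂) c t = begin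
    eCount c ((suc k ∷ B₁ ++ k ∷ B₂) ++ t)        ≡⟨ cong (λ u → eCount c (suc k ∷ u)) (++-assoc B₁ (k ∷ B₂) t) ⟩
    eStep (suc k) (eCount c (B₁ ++ k ∷ B₂ ++ t))  ≡⟨ cong (eStep (suc k)) (eCount-balanced-++ b₁ c (k ∷ B₂ ++ t)) ⟩
    eStep (suc k) (eStep k (eCount c (B₂ ++ t)))  ≡⟨ cong (eStep (suc k)) (eStep-k (eCount c (B₂ ++ t))) ⟩
    eStep (suc k) (suc (eCount c (B₂ ++ t)))      ≡⟨ eStep-suc-k _ ⟩
    eCount c (B₂ ++ t)                            ≡⟨ eCount-balanced-++ b₂ c t ⟩
    eCount c t                                    ∎

  eFlags-balanced-++ : ∀ {B} → Balanced B → ∀ c t → eFlags c (B ++ t) ≡ unflags B ++ eFlags c t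
  eFlags-balanced-++ [] c t = refl
  eFlags-balanced-++ (other {x} {B} x≢k x≢k+1 b) c t =
    cong₂ _∷_ (eFlag-other (eCount c (B ++ t)) x≢k x≢k+1) (eFlags-balanced-++ b c t)
  eFlags-balanced-++ (pair {B₁} {B₂} b₁ b₂) c t = begin
    eFlags c ((suc k ∷ B₁ ++ k ∷ B₂) ++ t)
      ≡⟨ cong (λ u → eFlags c (suc k ∷ u)) (++-assoc B₁ (k ∷ B₂) t) ⟩
    eFlag (suc k) (eCount c (B₁ ++ k ∷ B₂ ++ t)) ∷ eFlags c (B₁ ++ k ∷ B₂ ++ t)
      ≡⟨ cong₂ _∷_ opener-paired (eFlags-balanced-++ b₁ c (k ∷ B₂ ++ t)) ⟩
    false ∷ unflags B₁ ++ eFlag k (eCount c (B₂ ++ t)) ∷ eFlags c (B₂ ++ t)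
      ≡⟨ cong (λ u → false ∷ unflags B₁ ++ u)
              (cong₂ _∷_ (eFlag-k (eCount c (B₂ ++ t))) (eFlags-balanced-++ b₂ c t)) ⟩
    false ∷ unflags B₁ ++ false ∷ unflags B₂ ++ eFlags c t
      ≡⟨ cong (false ∷_) (unflags-++-∷ B₁ B₂ (eFlags c t)) ⟩
    unflags (suc k ∷ B₁ ++ k ∷ B₂) ++ eFlags c t ∎
    where
    opener-paired : eFlag (suc k) (eCount c (B₁ ++ k ∷ B₂ ++ t)) ≡ false
    opener-paired rewrite eCount-balanced-++ b₁ c (k ∷ B₂ ++ t) | eStep-k (eCount c (B₂ ++ t))
                        | eFlag-suc-k (suc (eCount c (B₂ ++ t))) = refl

  zipB-eFlags-balanced-++ : ∀ {B} → Balanced B → ∀ t →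
                            zipB (B ++ t) (eFlags 0 (B ++ t)) ≡ unflagged B ++ zipB t (eFlags 0 t)
  zipB-eFlags-balanced-++ {B} b t rewrite eFlags-balanced-++ b 0 t = zipB-unflags-++ B t (eFlags 0 t)

  eCount-blocks : ∀ m {Bs} → All Balanced Bs → m ≤ length Bs → eCount 0 (blocks m Bs) ≡ m
  eCount-blocks zero    []                _         = refl
  eCount-blocks zero    {B ∷ Bs} (b ∷ bs) _
    rewrite eCount-balanced-++ b 0 (blocks 0 Bs) | eCount-blocks zero bs z≤n = eStep-suc-k 0
  eCount-blocks (suc m) {B ∷ Bs} (b ∷ bs) (s≤s m≤L)
    rewrite eCount-balanced-++ b 0 (blocks m Bs) | eCount-blocks m bs m≤L = eStep-k m

  changeFirst-blocks-lt : ∀ m {Bs} → All Balanced Bs → m < length Bs →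
                          changeFirst k (zipB (blocks m Bs) (eFlags 0 (blocks m Bs))) ≡ just (blocks (suc m) Bs)
  changeFirst-blocks-lt zero {B ∷ Bs} (b ∷ bs) _
    rewrite eCount-balanced-++ b 0 (blocks 0 Bs) | eCount-blocks 0 bs z≤n | eFlag-suc-k 0 =
    cong (λ u → just (k ∷ u)) (map-proj₁-zipB (B ++ blocks 0 Bs) _)
  changeFirst-blocks-lt (suc m) {B ∷ Bs} (b ∷ bs) (s≤s m<L)
    rewrite eFlag-k (eCount 0 (B ++ blocks m Bs)) | zipB-eFlags-balanced-++ b (blocks m Bs)
          | changeFirst-unflagged-++ k B (zipB (blocks m Bs) (eFlags 0 (blocks m Bs)))
          | changeFirst-blocks-lt m bs m<L = refl

  changeFirst-blocks-full : ∀ {Bs} → All Balanced Bs →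
                            changeFirst k (zipB (blocks (length Bs) Bs) (eFlags 0 (blocks (length Bs) Bs))) ≡ nothing
  changeFirst-blocks-full []                = refl
  changeFirst-blocks-full {B ∷ Bs} (b ∷ bs)
    rewrite eFlag-k (eCount 0 (B ++ blocks (length Bs) Bs)) | zipB-eFlags-balanced-++ b (blocks (length Bs) Bs)
          | changeFirst-unflagged-++ k B (zipB (blocks (length Bs) Bs) (eFlags 0 (blocks (length Bs) Bs)))
          | changeFirst-blocks-full bs = refl

  data NeutralReplacement : ℕ → ℕ → Set where
    same    : ∀ {x} → NeutralReplacement x x
    replace : ∀ {x y} → x ≢ k → y ≢ k → y ≢ suc k → NeutralReplacement x y

  eStep-mono : ∀ x {d d′} → d ≤ d′ → eStep x d ≤ eStep x d′
  eStep-mono x {d} {d′} d≤d′ with x ≟ k | x ≟ suc k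
  ... | yes refl | _        rewrite eStep-k d | eStep-k d′ = s≤s d≤d′
  ... | no _     | yes refl rewrite eStep-suc-k d | eStep-suc-k d′ = ∸-monoˡ-≤ 1 d≤d′
  ... | no x≢k   | no x≢k+1 rewrite eStep-other d x≢k x≢k+1 | eStep-other d′ x≢k x≢k+1 = d≤d′

  eStep-≤ : ∀ {x} d → x ≢ k → eStep x d ≤ d
  eStep-≤ {x} d x≢k with x ≟ suc k
  ... | yes refl rewrite eStep-suc-k d = m∸n≤m d 1
  ... | no x≢k+1 rewrite eStep-other d x≢k x≢k+1 = ≤-refl

  eFlag-false-mono : ∀ x {d d′} → d ≤ d′ → eFlag x d ≡ false → eFlag x d′ ≡ false
  eFlag-false-mono x {d} {d′} d≤d′ h with x ≟ k | x ≟ suc k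
  ... | yes refl | _        = eFlag-k d′
  ... | no x≢k   | no x≢k+1 = eFlag-other d′ x≢k x≢k+1
  eFlag-false-mono x {zero}  {d′}     d≤d′ h | no _ | yes refl with () ← trans (sym (eFlag-suc-k 0)) h
  eFlag-false-mono x {suc d} {suc d′} d≤d′ h | no _ | yes refl = eFlag-suc-k (suc d′)

  eCount-mono : ∀ c {w w′} → Pointwise NeutralReplacement w w′ → eCount c w ≤ eCount c w′
  eCount-mono c []                                = ≤-refl
  eCount-mono c (_∷_ {x = x} same pw)             = eStep-mono x (eCount-mono c pw)
  eCount-mono c (_∷_ {xs = xs} {ys = ys} (replace x≢k y≢k y≢k+1) pw) =
    ≤-trans (eStep-≤ (eCount c xs) x≢k)
            (≤-trans (eCount-mono c pw) (≤-reflexive (sym (eStep-other (eCount c ys) y≢k y≢k+1))))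

  eFlags-all-false-preserved : ∀ c {w w′} → Pointwise NeutralReplacement w w′ →
                             All (_≡ false) (eFlags c w) → All (_≡ false) (eFlags c w′)
  eFlags-all-false-preserved c []                    _        = []
  eFlags-all-false-preserved c (_∷_ {x = x} same pw) (h ∷ hs) =
    eFlag-false-mono x (eCount-mono c pw) h ∷ eFlags-all-false-preserved c pw hs
  eFlags-all-false-preserved c (_∷_ {ys = ys} (replace _ y≢k y≢k+1) pw) (_ ∷ hs) =
    eFlag-other (eCount c ys) y≢k y≢k+1 ∷ eFlags-all-false-preserved c pw hs

  length-eFlags : ∀ c w → length (eFlags c w) ≡ length w
  length-eFlags c []      = refl
  length-eFlags c (x ∷ w) = cong suc (length-eFlags c w)

  e-nothing-preserved : ∀ {w w′} → Pointwise NeutralReplacement w w′ → e k w ≡ nothing → e k w′ ≡ nothing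
  e-nothing-preserved {w} {w′} pw ew =
    trans (e-via-eFlags w′)
          (changeFirst-all-false k w′ (eFlags-all-false-preserved 0 pw
            (changeFirst-nothing⇒all-false k w (eFlags 0 w) (length-eFlags 0 w) (trans (sym (e-via-eFlags w)) ew))))

  module Shaped {B₀ Bs} (b₀ : Balanced B₀) (bs : All Balanced Bs) where

    shaped : ℕ → Word
    shaped m = B₀ ++ blocks m Bs

    f-shaped-zero : f k (shaped 0) ≡ nothing
    f-shaped-zero rewrite annotate-balanced-++ b₀ 0 (blocks 0 Bs)
                        | changeLast-unflagged-++ (suc k) B₀ (annotate 0 (blocks 0 Bs))
                        | changeLast-blocks-zero 0 bs = refl

    f-shaped-suc : ∀ m → m < length Bs → f k (shaped (suc m)) ≡ just (shaped m)
    f-shaped-suc m m<L rewrite annotate-balanced-++ b₀ 0 (blocks (suc m) Bs)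
                             | changeLast-unflagged-++ (suc k) B₀ (annotate 0 (blocks (suc m) Bs))
                             | changeLast-blocks-suc m bs m<L = refl

    e-shaped-lt : ∀ m → m < length Bs → e k (shaped m) ≡ just (shaped (suc m))
    e-shaped-lt m m<L rewrite e-via-eFlags (shaped m) | zipB-eFlags-balanced-++ b₀ (blocks m Bs)
                            | changeFirst-unflagged-++ k B₀ (zipB (blocks m Bs) (eFlags 0 (blocks m Bs)))
                            | changeFirst-blocks-lt m bs m<L = refl

    e-shaped-full : e k (shaped (length Bs)) ≡ nothing
    e-shaped-full rewrite e-via-eFlags (shaped (length Bs)) | zipB-eFlags-balanced-++ b₀ (blocks (length Bs) Bs)
                        | changeFirst-unflagged-++ k B₀ (zipB (blocks (length Bs) Bs) (eFlags 0 (blocks (length Bs) Bs)))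
                        | changeFirst-blocks-full bs = refl

    length-shaped : ∀ m → length Bs ≤ length (shaped m)
    length-shaped m = ≤-trans (length-blocks m Bs) (length-++-≤ʳ (blocks m Bs) {B₀})

    s-shaped : ∀ m → m ≤ length Bs → s k (shaped m) ≡ just (shaped (length Bs ∸ m))
    s-shaped = String.s-string k (length Bs) shaped f-shaped-zero f-shaped-suc e-shaped-lt e-shaped-full length-shaped

  record Decomposition (w : Word) : Set where
    constructor decomposition
    field
      prefix          : Word
      parts           : List Word
      unpaired        : ℕ
      prefix-balanced : Balanced prefix
      parts-balanced  : All Balanced parts
      unpaired≤       : unpaired ≤ length parts
      word≡           : w ≡ prefix ++ blocks unpaired parts

  -- A letter k+1 put in front either pairs with the first of the unpaired k's, absorbing it and
  -- the first block into the balanced prefix, or else becomes an unpaired k+1 itself.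
  decompose : ∀ w → Decomposition w
  decompose [] = decomposition [] [] 0 [] [] z≤n refl
  decompose (x ∷ w) with decompose w | x ≟ k | x ≟ suc k
  ... | decomposition B₀ Bs m b₀ bs m≤L eq | yes refl | _ =
    decomposition [] (B₀ ∷ Bs) (suc m) [] (b₀ ∷ bs) (s≤s m≤L) (cong (k ∷_) eq)
  ... | decomposition B₀ Bs zero b₀ bs _ eq | no _ | yes refl =
    decomposition [] (B₀ ∷ Bs) 0 [] (b₀ ∷ bs) z≤n (cong (suc k ∷_) eq)
  ... | decomposition B₀ (B₁ ∷ Bs) (suc m) b₀ (b₁ ∷ bs) (s≤s m≤L) eq | no _ | yes refl =
    decomposition (suc k ∷ B₀ ++ k ∷ B₁) Bs m (pair b₀ b₁) bs m≤L
                  (cong (suc k ∷_) (trans eq (sym (++-assoc B₀ (k ∷ B₁) (blocks m Bs)))))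
  ... | decomposition B₀ Bs m b₀ bs m≤L eq | no x≢k | no x≢k+1 =
    decomposition (x ∷ B₀) Bs m (other x≢k x≢k+1 b₀) bs m≤L (cong (x ∷_) eq)

  s-total : ∀ w → ∃ λ w′ → s k w ≡ just w′
  s-total w with decompose w
  ... | decomposition B₀ Bs m b₀ bs m≤L refl = _ , Shaped.s-shaped b₀ bs m m≤L

  s-involutive : ∀ {w w′} → s k w ≡ just w′ → s k w′ ≡ just w
  s-involutive {w} sw with decompose w
  ... | decomposition B₀ Bs m b₀ bs m≤L refl with trans (sym sw) (Shaped.s-shaped b₀ bs m m≤L)
  ... | refl = trans (Shaped.s-shaped b₀ bs (length Bs ∸ m) (m∸n≤m _ m))
                     (cong (λ u → just (B₀ ++ blocks u Bs)) (m∸[m∸n]≡n m≤L))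

  data Reflected : ℕ × Bool → ℕ → Set where
    fixed : ∀ {x b} → Reflected (x , b) x
    raise : Reflected (k , true) (suc k)
    lower : ∀ {b} → Reflected (suc k , b) k

  reflected-image : ∀ {x b y} → Reflected (x , b) y → x ≢ k → x ≢ suc k → y ≡ x
  reflected-image fixed _   _     = refl
  reflected-image raise x≢k _     = ⊥-elim (x≢k refl)
  reflected-image lower _   x≢k+1 = ⊥-elim (x≢k+1 refl)

  reflected-preimage : ∀ {z y} → Reflected z y → y ≢ k → y ≢ suc k → proj₁ z ≡ y
  reflected-preimage fixed _   _     = refl
  reflected-preimage raise _   y≢k+1 = ⊥-elim (y≢k+1 refl)
  reflected-preimage lower y≢k _     = ⊥-elim (y≢k refl)

  reflected-unflagged : ∀ B → Pointwise Reflected (unflagged B) B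
  reflected-unflagged []      = []
  reflected-unflagged (x ∷ B) = fixed ∷ reflected-unflagged B

  reflected-blocks-zero : ∀ o m′ {Bs} → All Balanced Bs →
                          Pointwise Reflected (annotate o (blocks 0 Bs)) (blocks m′ Bs)
  reflected-blocks-zero o m′ [] = []
  reflected-blocks-zero o zero {B ∷ Bs} (b ∷ bs)
    rewrite annotate-suc-k o (B ++ blocks 0 Bs) | annotate-balanced-++ b (suc o) (blocks 0 Bs) =
    fixed ∷ ++⁺ (reflected-unflagged B) (reflected-blocks-zero (suc o) 0 bs)
  reflected-blocks-zero o (suc m′) {B ∷ Bs} (b ∷ bs)
    rewrite annotate-suc-k o (B ++ blocks 0 Bs) | annotate-balanced-++ b (suc o) (blocks 0 Bs) =
    lower ∷ ++⁺ (reflected-unflagged B) (reflected-blocks-zero (suc o) m′ bs)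

  reflected-blocks : ∀ m m′ {Bs} → All Balanced Bs → Pointwise Reflected (annotate 0 (blocks m Bs)) (blocks m′ Bs)
  reflected-blocks zero    m′       bs = reflected-blocks-zero 0 m′ bs
  reflected-blocks (suc m) m′       [] = []
  reflected-blocks (suc m) zero     {B ∷ Bs} (b ∷ bs)
    rewrite annotate-k-unpaired (B ++ blocks m Bs) | annotate-balanced-++ b 0 (blocks m Bs) =
    raise ∷ ++⁺ (reflected-unflagged B) (reflected-blocks m 0 bs)
  reflected-blocks (suc m) (suc m′) {B ∷ Bs} (b ∷ bs)
    rewrite annotate-k-unpaired (B ++ blocks m Bs) | annotate-balanced-++ b 0 (blocks m Bs) =
    fixed ∷ ++⁺ (reflected-unflagged B) (reflected-blocks m m′ bs)

  s-reflected : ∀ {w w′} → s k w ≡ just w′ → Pointwise Reflected (annotate 0 w) w′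
  s-reflected {w} sw with decompose w
  ... | decomposition B₀ Bs m b₀ bs m≤L refl with trans (sym sw) (Shaped.s-shaped b₀ bs m m≤L)
  ... | refl rewrite annotate-balanced-++ b₀ 0 (blocks m Bs) =
    ++⁺ (reflected-unflagged B₀) (reflected-blocks m (length Bs ∸ m) bs)

  reflected-paired-k : ∀ {zs P′ ρ} → Pointwise Reflected zs P′ → PairedKThen ρ zs →
                       All (λ x → x ≢ k × x ≢ suc k) ρ → k ∷ ρ ⊆ P′
  reflected-paired-k (fixed ∷ pw) (here p)  aρ =
    refl ∷ ⊆-transfer (λ r (x≢k , x≢k+1) → reflected-image r x≢k x≢k+1) pw p aρ
  reflected-paired-k (_ ∷ pw)     (there p) aρ = _ ∷ʳ reflected-paired-k pw p aρ

  data Raised : ℕ × Bool → ℕ → Set where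
    fixed : ∀ {x} → Raised (x , false) x
    raise : Raised (k , true) (suc k)

  raised-image : ∀ {x b y} → Raised (x , b) y → x ≢ k → y ≡ x
  raised-image fixed _   = refl
  raised-image raise x≢k = ⊥-elim (x≢k refl)

  raised-unflagged : ∀ B → Pointwise Raised (unflagged B) B
  raised-unflagged []      = []
  raised-unflagged (x ∷ B) = fixed ∷ raised-unflagged B

  raised-blocks : ∀ {Bs} → All Balanced Bs → Pointwise Raised (annotate 0 (blocks (length Bs) Bs)) (blocks 0 Bs)
  raised-blocks [] = []
  raised-blocks {B ∷ Bs} (b ∷ bs)
    rewrite annotate-k-unpaired (B ++ blocks (length Bs) Bs) | annotate-balanced-++ b 0 (blocks (length Bs) Bs) =
    raise ∷ ++⁺ (raised-unflagged B) (raised-blocks bs)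

  s-raised : ∀ {w w′} → e k w ≡ nothing → s k w ≡ just w′ → Pointwise Raised (annotate 0 w) w′
  s-raised {w} ew sw with decompose w
  ... | decomposition B₀ Bs m b₀ bs m≤L refl with trans (sym sw) (Shaped.s-shaped b₀ bs m m≤L) | m ≟ length Bs
  ... | _    | no m≢L with () ← trans (sym (Shaped.e-shaped-lt b₀ bs m (≤∧≢⇒< m≤L m≢L))) ew
  ... | refl | yes refl rewrite n∸n≡0 (length Bs) | annotate-balanced-++ b₀ 0 (blocks (length Bs) Bs) =
    ++⁺ (raised-unflagged B₀) (raised-blocks bs)

  balanced-suc-k⇒k : ∀ {B} → Balanced B → suc k ∈ B → k ∈ B
  balanced-suc-k⇒k (other x≢k x≢k+1 b) (here refl) = ⊥-elim (x≢k+1 refl)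
  balanced-suc-k⇒k (other x≢k x≢k+1 b) (there p)   = there (balanced-suc-k⇒k b p)
  balanced-suc-k⇒k (pair {B₁} b₁ b₂)   _           = there (∈-++⁺ʳ B₁ (here refl))

  blocks-suc-k : ∀ m {Bs} → All Balanced Bs → suc k ∈ blocks m Bs →
                 m < length Bs ⊎ (∀ m′ → k ∈ blocks m′ Bs)
  blocks-suc-k zero    {B ∷ Bs} _        _         = inj₁ (s≤s z≤n)
  blocks-suc-k (suc m) {B ∷ Bs} (b ∷ bs) (here eq) = ⊥-elim (1+n≢n eq)
  blocks-suc-k (suc m) {B ∷ Bs} (b ∷ bs) (there p) with ∈-++⁻ B p
  ... | inj₁ q = inj₂ λ { zero     → there (∈-++⁺ˡ (balanced-suc-k⇒k b q))
                        ; (suc m′) → there (∈-++⁺ˡ (balanced-suc-k⇒k b q)) }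
  ... | inj₂ q with blocks-suc-k m bs q
  ... | inj₁ m<L = inj₁ (s≤s m<L)
  ... | inj₂ h   = inj₂ λ { zero → there (∈-++⁺ʳ B (h 0)) ; (suc m′) → there (∈-++⁺ʳ B (h m′)) }

  k∈blocks : ∀ m {Bs} → 0 < m → 0 < length Bs → k ∈ blocks m Bs
  k∈blocks (suc m) {B ∷ Bs} _ _ = here refl

  s-suc-k⇒k : ∀ {w w′} → s k w ≡ just w′ → suc k ∈ w → k ∈ w′
  s-suc-k⇒k {w} sw k+1∈w with decompose w
  ... | decomposition B₀ Bs m b₀ bs m≤L refl with trans (sym sw) (Shaped.s-shaped b₀ bs m m≤L) | ∈-++⁻ B₀ k+1∈w
  ... | refl | inj₁ p = ∈-++⁺ˡ (balanced-suc-k⇒k b₀ p)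
  ... | refl | inj₂ p with blocks-suc-k m bs p
  ... | inj₂ h   = ∈-++⁺ʳ B₀ (h _)
  ... | inj₁ m<L = ∈-++⁺ʳ B₀ (k∈blocks (length Bs ∸ m) (m<n⇒0<n∸m m<L) (≤-trans (s≤s z≤n) m<L))

open Signature

applySeq-total : ∀ js b → ∃ λ b′ → applySeq js b ≡ just b′
applySeq-total []       b = b , refl
applySeq-total (j ∷ js) b with s-total j b
... | b₁ , sb rewrite sb = applySeq-total js b₁

applySeq-reverse-inverse : ∀ js {x y} → applySeq (reverse js) x ≡ just y → applySeq js y ≡ just x
applySeq-reverse-inverse []       refl = refl
applySeq-reverse-inverse (j ∷ js) {x} {y} eq with applySeq-total (reverse js) x
... | y₀ , e₀ with s-total j y₀
... | y₁ , e₁ with just-injective (trans (sym reverse-applies) eq)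
  where
  open ≡-Reasoning
  reverse-applies : applySeq (reverse (j ∷ js)) x ≡ just y₁
  reverse-applies = begin
    applySeq (reverse (j ∷ js)) x               ≡⟨ cong (λ u → applySeq u x) (unfold-reverse j js) ⟩
    applySeq (reverse js ++ [ j ]) x            ≡⟨ applySeq-++ (reverse js) [ j ] x ⟩
    (applySeq (reverse js) x >>= applySeq [ j ]) ≡⟨ cong (_>>= applySeq [ j ]) e₀ ⟩
    (s j y₀ >>= applySeq [])                     ≡⟨ cong (_>>= applySeq []) e₁ ⟩
    just y₁                                     ∎
... | refl rewrite s-involutive j e₁ = applySeq-reverse-inverse js e₀

down-cons : ∀ a {c} → c ≤ suc a → down (suc a) c ≡ suc a ∷ down a c
down-cons a {c} c≤1+a with c ≤ᵇ suc a | ≤ᵇ-reflects-≤ c (suc a)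
... | true  | _       = refl
... | false | ofⁿ c≰ = ⊥-elim (c≰ c≤1+a)

down-nil : ∀ a {c} → a < c → down a c ≡ []
down-nil zero    {suc c} _   = refl
down-nil (suc a) {c}     a<c with c ≤ᵇ suc a | ≤ᵇ-reflects-≤ c (suc a)
... | true  | ofʸ c≤ = ⊥-elim (<⇒≱ a<c c≤)
... | false | _      = refl

down-self : ∀ a → down a a ≡ [ a ]
down-self zero    = refl
down-self (suc a) = trans (down-cons a ≤-refl) (cong (suc a ∷_) (down-nil a ≤-refl))

down-snoc : ∀ a {c} → c ≤ a → down a c ≡ down a (suc c) ++ [ c ]
down-snoc zero    {zero} _ = refl
down-snoc (suc a) {c} c≤1+a with c ≟ suc a
... | yes refl = trans (down-self (suc a)) (cong (_++ [ suc a ]) (sym (down-nil (suc a) ≤-refl)))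
... | no c≢1+a = begin
  down (suc a) c                              ≡⟨ down-cons a c≤1+a ⟩
  suc a ∷ down a c                            ≡⟨ cong (suc a ∷_) (down-snoc a c≤a) ⟩
  suc a ∷ down a (suc c) ++ [ c ]             ≡⟨ cong (_++ [ c ]) (sym (down-cons a (s≤s c≤a))) ⟩
  down (suc a) (suc c) ++ [ c ]               ∎
  where
  open ≡-Reasoning
  c≤a : c ≤ a
  c≤a = ≤-pred (≤∧≢⇒< c≤1+a c≢1+a)

All-≥-down : ∀ a c → All (c ≤_) (down a c)
All-≥-down zero    zero    = z≤n ∷ []
All-≥-down zero    (suc c) = []
All-≥-down (suc a) c with c ≤ᵇ suc a | ≤ᵇ-reflects-≤ c (suc a)
... | true  | ofʸ c≤ = c≤ ∷ All-≥-down a c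
... | false | _      = []

All-≤-down : ∀ a c → All (_≤ a) (down a c)
All-≤-down zero    zero    = z≤n ∷ []
All-≤-down zero    (suc c) = []
All-≤-down (suc a) c with c ≤ᵇ suc a
... | true  = ≤-refl ∷ All.map m≤n⇒m≤1+n (All-≤-down a c)
... | false = []

firstIn-other : ∀ i {x} w → x ≢ i → x ≢ suc i → firstIn i (x ∷ w) ≡ firstIn i w
firstIn-other i w x≢i x≢i+1 rewrite ≢⇒≡ᵇ-false x≢i | ≢⇒≡ᵇ-false x≢i+1 = refl

firstIn-just⇒∈ : ∀ i w {y} → firstIn i w ≡ just y → y ∈ w
firstIn-just⇒∈ i (x ∷ w) eq with (x ≡ᵇ i) ∨ (x ≡ᵇ suc i)
... | true  = here (sym (just-injective eq))
... | false = there (firstIn-just⇒∈ i w eq)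

firstIn-before : ∀ i X Y → firstIn i (X ++ i ∷ Y) ≡ just (suc i) → suc i ∈ X
firstIn-before i []      Y eq rewrite ≡ᵇ-refl i = ⊥-elim (1+n≢n (sym (just-injective eq)))
firstIn-before i (x ∷ X) Y eq with x ≟ suc i | x ≟ i
... | yes refl | _        = here refl
... | no _     | yes refl rewrite ≡ᵇ-refl i = ⊥-elim (1+n≢n (sym (just-injective eq)))
... | no x≢i+1 | no x≢i   = there (firstIn-before i X Y (trans (sym (firstIn-other i (X ++ i ∷ Y) x≢i x≢i+1)) eq))

firstIn-two : ∀ w t → 2 ∈ w → 1 ∉ w → firstIn 1 (w ++ t) ≡ just 2
firstIn-two (x ∷ w) t (here refl) _   = refl
firstIn-two (x ∷ w) t (there 2∈w) 1∉ with x ≟ 2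
... | yes refl = refl
... | no x≢2   = trans (firstIn-other 1 (w ++ t) (λ x≡1 → 1∉ (here (sym x≡1))) x≢2)
                       (firstIn-two w t 2∈w (λ 1∈w → 1∉ (there 1∈w)))

eNeg1-other : ∀ {x} w → x ≢ 1 → x ≢ 2 → eNeg1 (x ∷ w) ≡ (eNeg1 w >>= λ r → just (x ∷ r))
eNeg1-other w x≢1 x≢2 rewrite ≢⇒≡ᵇ-false x≢1 | ≢⇒≡ᵇ-false x≢2 = refl

eNeg1-two : ∀ w → firstIn 1 w ≡ just 2 → ∃ λ w′ → eNeg1 w ≡ just w′ × firstIn 1 w′ ≡ just 1
eNeg1-two (x ∷ w) eq with x ≟ 1 | x ≟ 2
... | yes refl | _        with () ← eq
... | no _     | yes refl = 1 ∷ w , refl , refl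
... | no x≢1   | no x≢2   with eNeg1-two w (trans (sym (firstIn-other 1 w x≢1 x≢2)) eq)
... | w′ , e₁ , f₁ = x ∷ w′ , trans (eNeg1-other w x≢1 x≢2) (cong (_>>= λ r → just (x ∷ r)) e₁) ,
                     trans (firstIn-other 1 w′ x≢1 x≢2) f₁

eNeg1-one : ∀ w → firstIn 1 w ≡ just 1 → eNeg1 w ≡ nothing
eNeg1-one (x ∷ w) eq with x ≟ 1 | x ≟ 2
... | yes refl | _        = refl
... | no _     | yes refl with () ← eq
... | no x≢1   | no x≢2
  rewrite eNeg1-other w x≢1 x≢2 | eNeg1-one w (trans (sym (firstIn-other 1 w x≢1 x≢2)) eq) = refl

first-occurrence : ∀ {x} w → x ∈ w → ∃₂ λ P R → w ≡ P ++ x ∷ R × x ∉ P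
first-occurrence     (y ∷ w) (here refl) = [] , w , refl , λ ()
first-occurrence {x} (y ∷ w) (there p) with y ≟ x
... | yes refl = [] , w , refl , λ ()
... | no y≢x with first-occurrence w p
... | P , R , refl , x∉P = y ∷ P , R , refl , λ { (here x≡y) → y≢x (sym x≡y) ; (there q) → x∉P q }

raised⇒neutral : ∀ {j k zs ys} → j < k → Pointwise (Raised k) zs ys →
                 Pointwise (NeutralReplacement j) (map proj₁ zs) ys
raised⇒neutral j<k []           = []
raised⇒neutral j<k (fixed ∷ pw) = same ∷ raised⇒neutral j<k pw
raised⇒neutral j<k (raise ∷ pw) =
  replace (>⇒≢ j<k) (>⇒≢ (m<n⇒m<1+n j<k)) (>⇒≢ (s≤s j<k)) ∷ raised⇒neutral j<k pw

highest-weight-after-raise : ∀ {j k u u′} → j < k → Pointwise (Raised k) (annotate k 0 u) u′ →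
                             e j u ≡ nothing → e j u′ ≡ nothing
highest-weight-after-raise {j} {k} {u} {u′} j<k pw =
  e-nothing-preserved j
    (subst (λ v → Pointwise (NeutralReplacement j) v u′) (map-proj₁-annotate k 0 u) (raised⇒neutral j<k pw))

Guarded : ℕ → ℕ → Word → Set
Guarded i a u = ∀ X Y → u ≡ X ++ suc a ∷ Y → down (suc i) (suc (suc a)) ⊆ X

guard-extends : ∀ {i a u V W} → suc a ≤ i → Guarded i (suc a) u → u ≡ V ++ W → suc (suc a) ∈ V →
                down (suc i) (suc (suc a)) ⊆ V
guard-extends {i} {a} {W = W} a<i g u≡ a+2∈V with ∈-∃++ a+2∈V
... | V₁ , V₂ , refl = subst (_⊆ V₁ ++ suc (suc a) ∷ V₂) (sym (down-snoc (suc i) (s≤s a<i)))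
                             (⊆-++⁺ (g V₁ (V₂ ++ W) (trans u≡ (++-assoc V₁ _ W))) (refl ∷ minimum V₂))

-- A letter a+1 of s_{a+1} u comes from a paired a+1 of u, hence from one preceded by an a+2.
guarded-after-raise : ∀ {i a u u′} → suc a ≤ i → Guarded i (suc a) u →
                      Pointwise (Raised (suc a)) (annotate (suc a) 0 u) u′ → Guarded i a u′
guarded-after-raise {i} {a} {u} a<i g pw X′ Y′ refl with Pointwise-++ʳ⁻ X′ (suc a ∷ Y′) pw
... | ZX , _ ∷ ZY , ann≡ , pX , fixed ∷ _ with paired-k⇒opener (suc a) 0 u ZX ZY ann≡
... | inj₂ opener =
  ⊆-transfer (λ r x≢k → raised-image (suc a) r x≢k) pX (guard-extends a<i g u≡ opener) letters≢a+1
  where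
  u≡ : u ≡ map proj₁ ZX ++ suc a ∷ map proj₁ ZY
  u≡ = trans (sym (map-proj₁-annotate (suc a) 0 u)) (trans (cong (map proj₁) ann≡) (map-++ proj₁ ZX _))
  letters≢a+1 : All (_≢ suc a) (down (suc i) (suc (suc a)))
  letters≢a+1 = All.map (λ a+2≤x x≡a+1 → 1+n≰n (≤-trans a+2≤x (≤-reflexive x≡a+1)))
                        (All-≥-down (suc i) (suc (suc a)))

StageOneInvariant : ℕ → ℕ → Word → Set
StageOneInvariant i a u = (∀ j → 0 < j → j ≤ a → e j u ≡ nothing) × Guarded i a u × suc i ∈ u

stage-one-step : ∀ {i a u u′} → suc a ≤ i → StageOneInvariant i (suc a) u → s (suc a) u ≡ just u′ →
                 StageOneInvariant i a u′
stage-one-step {i} {a} {u} {u′} a<i (hw , g , i+1∈u) su = hw′ , guarded-after-raise a<i g pw , i+1∈u′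
  where
  pw : Pointwise (Raised (suc a)) (annotate (suc a) 0 u) u′
  pw = s-raised (suc a) (hw (suc a) (s≤s z≤n) ≤-refl) su
  hw′ : ∀ j → 0 < j → j ≤ a → e j u′ ≡ nothing
  hw′ j 0<j j≤a = highest-weight-after-raise (s≤s j≤a) pw (hw j 0<j (m≤n⇒m≤1+n j≤a))
  i+1∈u′ : suc i ∈ u′
  i+1∈u′ = to∈ (⊆-transfer (λ r x≢k → raised-image (suc a) r x≢k) pw
                  (from∈ (subst (suc i ∈_) (sym (map-proj₁-annotate (suc a) 0 u)) i+1∈u)) (>⇒≢ (s≤s a<i) ∷ []))

stage-one : ∀ {i} a {u} → a < i → StageOneInvariant i a u →
            ∃ λ c → applySeq (down a 1) u ≡ just c × StageOneInvariant i 0 c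
stage-one zero    {u} _   inv = u , refl , inv
stage-one (suc a) {u} a<i inv with s-total (suc a) u
... | u′ , su rewrite su = stage-one a (<⇒≤ a<i) (stage-one-step (<⇒≤ a<i) inv su)

FirstOneGuarded : ℕ → Word → Set
FirstOneGuarded k w = (suc k ∈ w × 1 ∉ w) ⊎ (∃₂ λ P R → w ≡ P ++ 1 ∷ R × 1 ∉ P × down (suc k) 2 ⊆ P)

first-one-guarded : ∀ {i c} → StageOneInvariant i 0 c → FirstOneGuarded i c
first-one-guarded {c = c} (_ , g , i+1∈c) with 1 ∈? c
... | no 1∉c = inj₁ (i+1∈c , 1∉c)
... | yes 1∈c with first-occurrence c 1∈c
... | P , R , c≡ , 1∉P = inj₂ (P , R , c≡ , 1∉P , g P R c≡)

one-not-created : ∀ k {w w′} → 2 ≤ k → Pointwise (Reflected k) (annotate k 0 w) w′ → 1 ∉ w → 1 ∉ w′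
one-not-created k {w} 2≤k pw 1∉w 1∈w′ =
  1∉w (subst (1 ∈_) (map-proj₁-annotate k 0 w)
                   (∈-transfer⁻ (λ r → reflected-preimage k r (<⇒≢ 2≤k) (<⇒≢ (m<n⇒m<1+n 2≤k))) pw 1∈w′))

reflected-around-one : ∀ {k P R w′} → 2 ≤ k → Pointwise (Reflected k) (annotate k 0 (P ++ 1 ∷ R)) w′ →
                       ∃₂ λ P′ R′ → w′ ≡ P′ ++ 1 ∷ R′ × Pointwise (Reflected k) (annotate k 0 P) P′
reflected-around-one {k} {P} {R} {w′} 2≤k pw with annotate-++ k 0 P (1 ∷ R)
... | o′ , ann≡
  with Pointwise-++ˡ⁻ (annotate k 0 P) (annotate k o′ (1 ∷ R)) (subst (λ v → Pointwise (Reflected k) v w′) ann≡ pw)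
... | P′ , Q′ , refl , pP , pQ with subst (λ v → Pointwise (Reflected k) v Q′) (annotate-∷ k o′ 1 R) pQ
... | r ∷ _ = P′ , _ , cong (λ y → P′ ++ y ∷ _) (reflected-image k r (<⇒≢ 2≤k) (<⇒≢ (m<n⇒m<1+n 2≤k))) , pP

down-avoids : ∀ a c → All (λ x → x ≢ suc a × x ≢ suc (suc a)) (down a c)
down-avoids a c = All.map (λ x≤a → <⇒≢ (s≤s x≤a) , <⇒≢ (m<n⇒m<1+n (s≤s x≤a))) (All-≤-down a c)

-- A letter K following a K+1 is paired, so s_K keeps it, and s_K does not touch the letters below K.
first-one-guarded-step : ∀ k {w w′} → s (suc (suc k)) w ≡ just w′ →
                         FirstOneGuarded (suc (suc k)) w → FirstOneGuarded (suc k) w′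
first-one-guarded-step k su (inj₁ (k+3∈w , 1∉w)) =
  inj₁ (s-suc-k⇒k (suc (suc k)) su k+3∈w ,
        one-not-created (suc (suc k)) (s≤s (s≤s z≤n)) (s-reflected (suc (suc k)) su) 1∉w)
first-one-guarded-step k su (inj₂ (P , R , refl , 1∉P , guard))
  with reflected-around-one (s≤s (s≤s z≤n)) (s-reflected (suc (suc k)) su)
... | P′ , R′ , refl , pP =
  inj₂ (P′ , R′ , refl , one-not-created (suc (suc k)) (s≤s (s≤s z≤n)) pP 1∉P ,
        reflected-paired-k (suc (suc k)) pP (opener-then-paired-k (suc (suc k)) 0 P guard) (down-avoids (suc k) 2))

stage-two : ∀ k {w} → FirstOneGuarded (suc k) w →
            ∃ λ t → applySeq (down (suc k) 2) w ≡ just t × firstIn 1 t ≡ just 2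
stage-two zero    {w} (inj₁ (2∈w , 1∉w)) =
  w , refl , subst (λ v → firstIn 1 v ≡ just 2) (++-identityʳ w) (firstIn-two w [] 2∈w 1∉w)
stage-two zero    (inj₂ (P , R , refl , 1∉P , guard)) = _ , refl , firstIn-two P (1 ∷ R) (to∈ guard) 1∉P
stage-two (suc k) {w} inv with s-total (suc (suc k)) w
... | w′ , su rewrite su = stage-two k (first-one-guarded-step k su inv)

εNeg≡1 : ∀ i b {t} → applySeq (preSeq i) b ≡ just t → firstIn 1 t ≡ just 2 → EpsNegIs i b 1
εNeg≡1 i b {t} reach first with eNeg1-two t first
... | t′ , lowered , first′ with applySeq-total (reverse (preSeq i)) t′
... | b₁ , back = nonzero , vanishes
  where
  eNeg-b : eNeg i b ≡ just b₁
  eNeg-b rewrite reach | lowered = back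
  eNeg-b₁ : eNeg i b₁ ≡ nothing
  eNeg-b₁ rewrite applySeq-reverse-inverse (preSeq i) back | eNeg1-one t′ first′ = refl
  nonzero : iterOp (eNeg i) 1 b ≢ nothing
  nonzero eq with () ← trans (sym eNeg-b) eq
  vanishes : ∀ m → 1 < m → iterOp (eNeg i) m b ≡ nothing
  vanishes m 1<m = iterOp-≤-nothing (eNeg i) b 1<m (trans (cong (_>>= eNeg i) eNeg-b) eNeg-b₁)

guarded-initially : ∀ i {b} → firstIn (suc i) b ≡ just (suc (suc i)) → Guarded (suc i) i b
guarded-initially i first X Y b≡ =
  subst (_⊆ X) (sym (down-self (suc (suc i))))
        (from∈ (firstIn-before (suc i) X Y (trans (cong (firstIn (suc i)) (sym b≡)) first)))

applySeq-preSeq : ∀ i {b c t} → applySeq (down i 1) b ≡ just c → applySeq (down (suc i) 2) c ≡ just t →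
                  applySeq (preSeq (suc i)) b ≡ just t
applySeq-preSeq i {b} reach-c reach-t =
  trans (applySeq-++ (down i 1) (down (suc i) 2) b) (trans (cong (_>>= applySeq (down (suc i) 2)) reach-c) reach-t)

lemma2p7 : (n ℓ : ℕ) → 1 ≤ n → 1 ≤ ℓ →
           (i : ℕ) → 1 ≤ i → i ≤ n →
           (b : List ℕ) → length b ≡ ℓ → All (λ x → 1 ≤ x × x ≤ suc n) b →
           (∀ j → 1 ≤ j → j < i → e j b ≡ nothing) →
           firstIn i b ≡ just (suc i) →
           EpsNegIs i b 1
lemma2p7 _ _ _ _ (suc i) _ _ b _ _ hw first
  with stage-one i ≤-refl ((λ j 0<j j≤i → hw j 0<j (s≤s j≤i)) , guarded-initially i first ,
                           firstIn-just⇒∈ (suc i) b first)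
... | c , reach-c , inv-c with stage-two i (first-one-guarded inv-c)
... | t , reach-t , first-t = εNeg≡1 (suc i) b (applySeq-preSeq i reach-c reach-t) first-t
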